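{- Let $k\ge2$ and $n_1,\dots,n_k\ge2$ be integers. Then $\Gamma(\mathbb{Z}_{n_1}\times\cdots\times\mathbb{Z}_{n_k})$ is bipartite if and only if $k=2$ and either both $n_1,n_2$ are prime, or one of $n_1,n_2$ is prime and the other equals $4$.
   Context: For a commutative ring $R$ with identity, the zero-divisor graph $\Gamma(R)$ is the simple undirected graph whose vertices are the nonzero zero-divisors of $R$, two distinct vertices $u,v$ being adjacent iff $uv=0$. -}

module Defs where

open import Data.Nat using (ℕ; zero; suc; _*_)
open import Data.Nat.DivMod using (_mod_)
open import Data.Fin using (Fin; toℕ)
open import Data.List using (List; []; _∷_)
open import Data.Bool using (Bool)
open import Data.Unit using (⊤; tt)
open import Data.Product using (_×_; _,_; ∃)
open import Relation.Nullary using (¬_)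
open import Relation.Binary.PropositionalEquality using (_≡_; _≢_)

mulMod : ∀ {m} → Fin m → Fin m → Fin m
mulMod {suc m} a b = (toℕ a * toℕ b) mod suc m

Elem : List ℕ → Set
Elem []       = ⊤
Elem (n ∷ ns) = Fin n × Elem ns

mul : ∀ {ns} → Elem ns → Elem ns → Elem ns
mul {[]}     tt       tt       = tt
mul {n ∷ ns} (a , x)  (b , y)  = mulMod a b , mul x y

IsZero : ∀ {ns} → Elem ns → Set
IsZero {[]}     tt      = ⊤
IsZero {n ∷ ns} (a , x) = toℕ a ≡ 0 × IsZero x

-- Vertices of Γ(R): nonzero zero-divisors.
Vertex : ∀ {ns} → Elem ns → Set
Vertex {ns} x = ¬ IsZero x × ∃ λ (y : Elem ns) → ¬ IsZero y × IsZero (mul x y)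

Adj : ∀ {ns} → Elem ns → Elem ns → Set
Adj u v = Vertex u × Vertex v × u ≢ v × IsZero (mul u v)

IsBipartiteΓ : List ℕ → Set
IsBipartiteΓ ns = ∃ λ (c : Elem ns → Bool) → ∀ u v → Adj u v → c u ≢ c v

-- Three or more factors: the idempotents (1,0,0,…), (0,1,0,…), (0,0,1,…) form a triangle.
-- Two factors: if ℤ_n₁ has distinct nonzero a, b with ab = 0, then (a,0), (b,0), (0,1)
-- form a triangle; the only n ≥ 2 without such a pair are the primes and 4, and ℤ_4 × ℤ_4
-- contains the triangle (2,0), (0,2), (2,2).  Conversely, for ℤ_p × ℤ_q and ℤ_p × ℤ_4
-- with p, q prime, colour a vertex by whether its first coordinate vanishes: two vertices
-- with nonzero first coordinates cannot annihilate each other because ℤ_p is a field, and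
-- two vertices (0,b), (0,b') with bb' = 0 must coincide, since the only annihilating pair
-- of nonzero elements of ℤ_q or ℤ_4 is 2 · 2 = 0 in ℤ_4.
module Submission where

open import Defs
open import Data.Nat using (ℕ; _≤_)
open import Data.Nat.Primality using (Prime)
open import Data.List using (List; []; _∷_; length)
open import Data.List.Relation.Unary.All using (All)
open import Data.Product using (_×_; ∃₂)
open import Data.Sum using (_⊎_)
open import Function.Bundles using (_⇔_)
open import Relation.Binary.PropositionalEquality using (_≡_)

open import Data.Bool using (Bool; true; false; not)
open import Data.Bool.Properties using (¬-not; not-involutive)
open import Data.Empty using (⊥-elim)
open import Data.Fin using (Fin; toℕ; fromℕ<) renaming (zero to 0F; suc to sucF)
open import Data.Fin.Properties using (toℕ-fromℕ<; toℕ<n)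
open import Data.List.Relation.Unary.All as All using (_∷_)
open import Data.Nat using (zero; suc; _*_; _%_; _<_; s≤s; z<s; ≢-nonZero; nonTrivial⇒n>1)
open import Data.Nat.DivMod using (_mod_)
open import Data.Nat.Divisibility using (_∣_; divides; ∣⇒≤; ∣-reflexive; m∣m*n; m%n≡0⇒n∣m; n∣m⇒m%n≡0)
open import Data.Nat.Primality using (composite; prime?; euclidsLemma; ¬prime⇒composite)
open import Data.Nat.Properties
open import Data.Product using (_,_; proj₁; proj₂; ∃)
open import Data.Sum using (inj₁; inj₂; [_,_]′)
open import Data.Unit using (tt)
open import Function using (_∘_)
open import Function.Bundles using (mk⇔)
open import Relation.Nullary using (¬_; yes; no)
open import Relation.Binary.PropositionalEquality using (_≢_; refl; sym; trans; cong; cong₂; subst; module ≡-Reasoning)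

toℕ-mulMod : ∀ {n} (a b : Fin (suc n)) → toℕ (mulMod a b) ≡ toℕ a * toℕ b % suc n
toℕ-mulMod a b = toℕ-fromℕ< _

mulMod-comm : ∀ {n} (a b : Fin n) → mulMod a b ≡ mulMod b a
mulMod-comm {suc n} a b = cong (_mod suc n) (*-comm (toℕ a) (toℕ b))

mulMod-zeroˡ : ∀ {n} {a : Fin n} (b : Fin n) → toℕ a ≡ 0 → toℕ (mulMod a b) ≡ 0
mulMod-zeroˡ {a = 0F} b refl = refl

mulMod-zeroʳ : ∀ {n} (a : Fin n) {b : Fin n} → toℕ b ≡ 0 → toℕ (mulMod a b) ≡ 0
mulMod-zeroʳ a {b} b≡0 = trans (cong toℕ (mulMod-comm a b)) (mulMod-zeroˡ a b≡0)

toℕ≢0⇒∤ : ∀ {n} (a : Fin n) → toℕ a ≢ 0 → ¬ n ∣ toℕ a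
toℕ≢0⇒∤ a a≢0 n∣a = <⇒≱ (toℕ<n a) (∣⇒≤ {{≢-nonZero a≢0}} n∣a)

HasNoZeroDivisors : ℕ → Set
HasNoZeroDivisors n = (a b : Fin n) → toℕ a ≢ 0 → toℕ b ≢ 0 → toℕ (mulMod a b) ≢ 0

AnnihilatingPairsEqual : ℕ → Set
AnnihilatingPairsEqual n = (a b : Fin n) → toℕ a ≢ 0 → toℕ b ≢ 0 → toℕ (mulMod a b) ≡ 0 → a ≡ b

HasDistinctAnnihilatingPair : ℕ → Set
HasDistinctAnnihilatingPair n =
  ∃₂ λ (a b : Fin n) → toℕ a ≢ 0 × toℕ b ≢ 0 × a ≢ b × toℕ (mulMod a b) ≡ 0

HasNonzeroSquareZero : ℕ → Set
HasNonzeroSquareZero n = ∃ λ (a : Fin n) → toℕ a ≢ 0 × toℕ (mulMod a a) ≡ 0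

prime⇒noZeroDivisors : ∀ {p} → Prime p → HasNoZeroDivisors p
prime⇒noZeroDivisors {suc p} pr a b a≢0 b≢0 ab≡0 =
  [ toℕ≢0⇒∤ a a≢0 , toℕ≢0⇒∤ b b≢0 ]′
    (euclidsLemma (toℕ a) (toℕ b) pr (m%n≡0⇒n∣m _ _ (trans (sym (toℕ-mulMod a b)) ab≡0)))

noZeroDivisors⇒annihilatingPairsEqual : ∀ {n} → HasNoZeroDivisors n → AnnihilatingPairsEqual n
noZeroDivisors⇒annihilatingPairsEqual noZD a b a≢0 b≢0 ab≡0 = ⊥-elim (noZD a b a≢0 b≢0 ab≡0)

annihilatingPairsEqual-4 : AnnihilatingPairsEqual 4
annihilatingPairsEqual-4 0F _ a≢0 _ _ = ⊥-elim (a≢0 refl)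
annihilatingPairsEqual-4 _ 0F _ b≢0 _ = ⊥-elim (b≢0 refl)
annihilatingPairsEqual-4 (sucF 0F)               (sucF 0F)               _ _ ()
annihilatingPairsEqual-4 (sucF 0F)               (sucF (sucF 0F))        _ _ ()
annihilatingPairsEqual-4 (sucF 0F)               (sucF (sucF (sucF 0F))) _ _ ()
annihilatingPairsEqual-4 (sucF (sucF 0F))        (sucF 0F)               _ _ ()
annihilatingPairsEqual-4 (sucF (sucF 0F))        (sucF (sucF 0F))        _ _ _ = refl
annihilatingPairsEqual-4 (sucF (sucF 0F))        (sucF (sucF (sucF 0F))) _ _ ()
annihilatingPairsEqual-4 (sucF (sucF (sucF 0F))) (sucF 0F)               _ _ ()
annihilatingPairsEqual-4 (sucF (sucF (sucF 0F))) (sucF (sucF 0F))        _ _ ()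
annihilatingPairsEqual-4 (sucF (sucF (sucF 0F))) (sucF (sucF (sucF 0F))) _ _ ()

nonzeroSquareZero-4 : HasNonzeroSquareZero 4
nonzeroSquareZero-4 = sucF (sucF 0F) , (λ ()) , refl

distinctAnnihilatingPair : ∀ {n a b} (a<n : a < suc n) (b<n : b < suc n) →
  a ≢ 0 → b ≢ 0 → a ≢ b → suc n ∣ a * b → HasDistinctAnnihilatingPair (suc n)
distinctAnnihilatingPair {n} {a} {b} a<n b<n a≢0 b≢0 a≢b n∣ab =
  fromℕ< a<n , fromℕ< b<n ,
  a≢0 ∘ trans (sym toℕa) , b≢0 ∘ trans (sym toℕb) ,
  (λ e → a≢b (trans (sym toℕa) (trans (cong toℕ e) toℕb))) ,
  product≡0
  where
  open ≡-Reasoning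
  toℕa = toℕ-fromℕ< a<n
  toℕb = toℕ-fromℕ< b<n
  product≡0 : toℕ (mulMod (fromℕ< a<n) (fromℕ< b<n)) ≡ 0
  product≡0 = begin
    toℕ (mulMod (fromℕ< a<n) (fromℕ< b<n))            ≡⟨ toℕ-mulMod (fromℕ< a<n) (fromℕ< b<n) ⟩
    toℕ (fromℕ< a<n) * toℕ (fromℕ< b<n) % suc n       ≡⟨ cong (_% suc n) (cong₂ _*_ toℕa toℕb) ⟩
    a * b % suc n                                     ≡⟨ n∣m⇒m%n≡0 (a * b) (suc n) n∣ab ⟩
    0                                                 ∎

properFactor⇒distinctAnnihilatingPair : ∀ {n d} q → 1 < d → d < suc n → suc n ≡ q * d →
  suc n ≢ 4 → HasDistinctAnnihilatingPair (suc n)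
properFactor⇒distinctAnnihilatingPair zero _ _ () _
properFactor⇒distinctAnnihilatingPair {n} {d} q@(suc _) 1<d d<n n≡qd n≢4 with d ≟ q
... | no d≢q = distinctAnnihilatingPair d<n q<n (m<n⇒n≢0 1<d) (λ ()) d≢q (∣-reflexive n≡dq)
  where
  q<n : q < suc n
  q<n = subst (q <_) (sym n≡qd) (m<m*n q d 1<d)
  n≡dq : suc n ≡ d * q
  n≡dq = trans n≡qd (*-comm q d)
-- With d = q the pair (d, d) is not distinct; take (d, 2d) instead, using n = d² > 2d as d ≠ 2.
... | yes refl = distinctAnnihilatingPair d<n 2d<n (m<n⇒n≢0 1<d) (m<n⇒n≢0 d<2d) (<⇒≢ d<2d) n∣d·2d
  where
  2<d : 2 < d
  2<d = ≤∧≢⇒< 1<d λ { refl → n≢4 n≡qd }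
  d<2d : d < d * 2
  d<2d = m<m*n d 2 ≤-refl
  2d<n : d * 2 < suc n
  2d<n = subst (d * 2 <_) (sym n≡qd) (*-monoʳ-< d 2<d)
  n∣d·2d : suc n ∣ d * (d * 2)
  n∣d·2d = subst (_∣ d * (d * 2)) (sym n≡qd) (subst (d * d ∣_) (*-assoc d d 2) (m∣m*n 2))

prime⊎four⊎distinctAnnihilatingPair : ∀ {n} → 2 ≤ n → Prime n ⊎ n ≡ 4 ⊎ HasDistinctAnnihilatingPair n
prime⊎four⊎distinctAnnihilatingPair {n@(suc (suc _))} (s≤s (s≤s _)) with prime? n | n ≟ 4
... | yes p  | _       = inj₁ p
... | no _   | yes n≡4 = inj₂ (inj₁ n≡4)
... | no ¬p  | no n≢4 with ¬prime⇒composite ¬p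
...   | composite {d} d<n (divides q n≡qd) =
  inj₂ (inj₂ (properFactor⇒distinctAnnihilatingPair q (nonTrivial⇒n>1 d) d<n n≡qd n≢4))

IsZero-mul-comm : ∀ {ns} (x y : Elem ns) → IsZero (mul x y) → IsZero (mul y x)
IsZero-mul-comm {[]}     tt      tt      tt            = tt
IsZero-mul-comm {n ∷ ns} (a , x) (b , y) (ab≡0 , xy≡0) =
  trans (cong toℕ (mulMod-comm b a)) ab≡0 , IsZero-mul-comm x y xy≡0

IsZero-mulˡ : ∀ {ns} (x y : Elem ns) → IsZero x → IsZero (mul x y)
IsZero-mulˡ {[]}     tt      tt      tt            = tt
IsZero-mulˡ {n ∷ ns} (a , x) (b , y) (a≡0 , x≡0) = mulMod-zeroˡ b a≡0 , IsZero-mulˡ x y x≡0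

0# : ∀ {ns} → All (0 <_) ns → Elem ns
0# All.[]       = tt
0# (s≤s _ ∷ ps) = 0F , 0# ps

IsZero-0# : ∀ {ns} (ps : All (0 <_) ns) → IsZero (0# ps)
IsZero-0# All.[]       = tt
IsZero-0# (s≤s _ ∷ ps) = refl , IsZero-0# ps

adjacent : ∀ {ns} {u v : Elem ns} → ¬ IsZero u → ¬ IsZero v → u ≢ v → IsZero (mul u v) → Adj u v
adjacent {u = u} {v} u≢0 v≢0 u≢v uv≡0 =
  (u≢0 , v , v≢0 , uv≡0) , (v≢0 , u , u≢0 , IsZero-mul-comm u v uv≡0) , u≢v , uv≡0

triangle⇒¬bipartite : ∀ {ns} (u v w : Elem ns) → Adj u v → Adj v w → Adj u w → ¬ IsBipartiteΓ ns
triangle⇒¬bipartite u v w uv vw uw (c , proper) = proper u w uw (begin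
  c u             ≡⟨ ¬-not (proper u v uv) ⟩
  not (c v)       ≡⟨ cong not (¬-not (proper v w vw)) ⟩
  not (not (c w)) ≡⟨ not-involutive (c w) ⟩
  c w             ∎)
  where open ≡-Reasoning

swap : ∀ {n₁ n₂} → Elem (n₁ ∷ n₂ ∷ []) → Elem (n₂ ∷ n₁ ∷ [])
swap (a , b , tt) = b , a , tt

IsZero-swap : ∀ {n₁ n₂} (x : Elem (n₁ ∷ n₂ ∷ [])) → IsZero x → IsZero (swap x)
IsZero-swap _ (a≡0 , b≡0 , tt) = b≡0 , a≡0 , tt

Vertex-swap : ∀ {n₁ n₂} {x : Elem (n₁ ∷ n₂ ∷ [])} → Vertex x → Vertex (swap x)
Vertex-swap {x = x} (x≢0 , y , y≢0 , xy≡0) =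
  x≢0 ∘ IsZero-swap (swap x) , swap y , y≢0 ∘ IsZero-swap (swap y) , IsZero-swap (mul x y) xy≡0

Adj-swap : ∀ {n₁ n₂} {u v : Elem (n₁ ∷ n₂ ∷ [])} → Adj u v → Adj (swap u) (swap v)
Adj-swap {u = u} {v} (u-vertex , v-vertex , u≢v , uv≡0) =
  Vertex-swap u-vertex , Vertex-swap v-vertex , u≢v ∘ cong swap , IsZero-swap (mul u v) uv≡0

bipartite-swap : ∀ {n₁ n₂} → IsBipartiteΓ (n₁ ∷ n₂ ∷ []) → IsBipartiteΓ (n₂ ∷ n₁ ∷ [])
bipartite-swap (c , proper) = c ∘ swap , λ u v → proper (swap u) (swap v) ∘ Adj-swap

distinctAnnihilatingPair⇒¬bipartite : ∀ {n₁ n₂} → HasDistinctAnnihilatingPair n₁ → 2 ≤ n₂ →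
  ¬ IsBipartiteΓ (n₁ ∷ n₂ ∷ [])
distinctAnnihilatingPair⇒¬bipartite {zero} (() , _)
distinctAnnihilatingPair⇒¬bipartite {suc _} (a , b , a≢0 , b≢0 , a≢b , ab≡0) (s≤s (s≤s _)) =
  triangle⇒¬bipartite (a , 0F , tt) (b , 0F , tt) (0F , sucF 0F , tt)
    (adjacent (a≢0 ∘ proj₁) (b≢0 ∘ proj₁) (a≢b ∘ cong proj₁) (ab≡0 , refl , tt))
    (adjacent (b≢0 ∘ proj₁) (λ ()) (b≢0 ∘ cong (toℕ ∘ proj₁)) (mulMod-zeroʳ b refl , refl , tt))
    (adjacent (a≢0 ∘ proj₁) (λ ()) (a≢0 ∘ cong (toℕ ∘ proj₁)) (mulMod-zeroʳ a refl , refl , tt))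

nonzeroSquareZero⇒¬bipartite : ∀ {n₁ n₂} → HasNonzeroSquareZero n₁ → HasNonzeroSquareZero n₂ →
  ¬ IsBipartiteΓ (n₁ ∷ n₂ ∷ [])
nonzeroSquareZero⇒¬bipartite {zero} (() , _)
nonzeroSquareZero⇒¬bipartite {suc _} {zero} _ (() , _)
nonzeroSquareZero⇒¬bipartite {suc _} {suc _} (a , a≢0 , aa≡0) (b , b≢0 , bb≡0) =
  triangle⇒¬bipartite (a , 0F , tt) (0F , b , tt) (a , b , tt)
    (adjacent (a≢0 ∘ proj₁) (b≢0 ∘ proj₁ ∘ proj₂) (a≢0 ∘ cong (toℕ ∘ proj₁))
      (mulMod-zeroʳ a refl , refl , tt))
    (adjacent (b≢0 ∘ proj₁ ∘ proj₂) (a≢0 ∘ proj₁) (a≢0 ∘ sym ∘ cong (toℕ ∘ proj₁))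
      (refl , bb≡0 , tt))
    (adjacent (a≢0 ∘ proj₁) (a≢0 ∘ proj₁) (b≢0 ∘ sym ∘ cong (toℕ ∘ proj₁ ∘ proj₂))
      (aa≡0 , refl , tt))

threeFactors⇒¬bipartite : ∀ {n₁ n₂ n₃ ns} → All (2 ≤_) (n₁ ∷ n₂ ∷ n₃ ∷ ns) →
  ¬ IsBipartiteΓ (n₁ ∷ n₂ ∷ n₃ ∷ ns)
threeFactors⇒¬bipartite (s≤s (s≤s _) ∷ s≤s (s≤s _) ∷ s≤s (s≤s _) ∷ ps) =
  triangle⇒¬bipartite e₁ e₂ e₃
    (adjacent (λ { (() , _) }) (λ { (_ , () , _) }) (λ ()) (refl , refl , refl , oo≡0))
    (adjacent (λ { (_ , () , _) }) (λ { (_ , _ , () , _) }) (λ ()) (refl , refl , refl , oo≡0))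
    (adjacent (λ { (() , _) }) (λ { (_ , _ , () , _) }) (λ ()) (refl , refl , refl , oo≡0))
  where
  o = 0# (All.map (<-trans z<s) ps)
  oo≡0 : IsZero (mul o o)
  oo≡0 = IsZero-mulˡ o o (IsZero-0# _)
  1F : ∀ {k} → Fin (suc (suc k))
  1F = sucF 0F
  e₁ = 1F , 0F , 0F , o
  e₂ = 0F , 1F , 0F , o
  e₃ = 0F , 0F , 1F , o

noZeroDivisors×annihilatingPairsEqual⇒bipartite : ∀ {n₁ n₂} → HasNoZeroDivisors n₁ →
  AnnihilatingPairsEqual n₂ → IsBipartiteΓ (n₁ ∷ n₂ ∷ [])
noZeroDivisors×annihilatingPairsEqual⇒bipartite {n₁} {n₂} noZD pairsEqual =
  (λ (a , _) → isZero a) , proper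
  where
  isZero : Fin n₁ → Bool
  isZero 0F       = true
  isZero (sucF _) = false
  proper : ∀ (u v : Elem (n₁ ∷ n₂ ∷ [])) → Adj u v → isZero (proj₁ u) ≢ isZero (proj₁ v)
  proper (0F , b , tt) (0F , b′ , tt) ((u≢0 , _) , (v≢0 , _) , u≢v , (_ , bb′≡0 , tt)) _ =
    u≢v (cong (λ x → 0F , x , tt)
      (pairsEqual b b′ (λ b≡0 → u≢0 (refl , b≡0 , tt)) (λ b′≡0 → v≢0 (refl , b′≡0 , tt)) bb′≡0))
  proper (0F     , _) (sucF _ , _) _ ()
  proper (sucF _ , _) (0F     , _) _ ()
  proper (sucF a , _) (sucF a′ , _) (_ , _ , _ , aa′≡0 , _) _ =
    noZD (sucF a) (sucF a′) (λ ()) (λ ()) aa′≡0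

BipartiteModuli : ℕ → ℕ → Set
BipartiteModuli n₁ n₂ = (Prime n₁ × Prime n₂) ⊎ (Prime n₁ × n₂ ≡ 4) ⊎ (n₁ ≡ 4 × Prime n₂)

bipartiteModuli⇒bipartite : ∀ {n₁ n₂} → BipartiteModuli n₁ n₂ → IsBipartiteΓ (n₁ ∷ n₂ ∷ [])
bipartiteModuli⇒bipartite (inj₁ (p₁ , p₂)) =
  noZeroDivisors×annihilatingPairsEqual⇒bipartite (prime⇒noZeroDivisors p₁)
    (noZeroDivisors⇒annihilatingPairsEqual (prime⇒noZeroDivisors p₂))
bipartiteModuli⇒bipartite (inj₂ (inj₁ (p₁ , refl))) =
  noZeroDivisors×annihilatingPairsEqual⇒bipartite (prime⇒noZeroDivisors p₁) annihilatingPairsEqual-4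
bipartiteModuli⇒bipartite (inj₂ (inj₂ (refl , p₂))) =
  bipartite-swap (bipartiteModuli⇒bipartite (inj₂ (inj₁ (p₂ , refl))))

bipartite⇒bipartiteModuli : ∀ {n₁ n₂} → 2 ≤ n₁ → 2 ≤ n₂ → IsBipartiteΓ (n₁ ∷ n₂ ∷ []) →
  BipartiteModuli n₁ n₂
bipartite⇒bipartiteModuli 2≤n₁ 2≤n₂ bipartite
  with prime⊎four⊎distinctAnnihilatingPair 2≤n₁ | prime⊎four⊎distinctAnnihilatingPair 2≤n₂
... | inj₂ (inj₂ pair₁) | _ = ⊥-elim (distinctAnnihilatingPair⇒¬bipartite pair₁ 2≤n₂ bipartite)
... | _ | inj₂ (inj₂ pair₂) =
  ⊥-elim (distinctAnnihilatingPair⇒¬bipartite pair₂ 2≤n₁ (bipartite-swap bipartite))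
... | inj₁ p₁           | inj₁ p₂           = inj₁ (p₁ , p₂)
... | inj₁ p₁           | inj₂ (inj₁ n₂≡4) = inj₂ (inj₁ (p₁ , n₂≡4))
... | inj₂ (inj₁ n₁≡4) | inj₁ p₂           = inj₂ (inj₂ (n₁≡4 , p₂))
... | inj₂ (inj₁ refl) | inj₂ (inj₁ refl) =
  ⊥-elim (nonzeroSquareZero⇒¬bipartite nonzeroSquareZero-4 nonzeroSquareZero-4 bipartite)

theorem3p3 : (ns : List ℕ) → 2 ≤ length ns → All (2 ≤_) ns →
    IsBipartiteΓ ns ⇔
      ∃₂ λ n₁ n₂ → ns ≡ n₁ ∷ n₂ ∷ [] ×
        ((Prime n₁ × Prime n₂) ⊎ (Prime n₁ × n₂ ≡ 4) ⊎ (n₁ ≡ 4 × Prime n₂))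
theorem3p3 []          ()            _
theorem3p3 (_ ∷ [])    (s≤s ())      _
theorem3p3 (n₁ ∷ n₂ ∷ []) _ (2≤n₁ ∷ 2≤n₂ ∷ All.[]) = mk⇔
  (λ bipartite → n₁ , n₂ , refl , bipartite⇒bipartiteModuli 2≤n₁ 2≤n₂ bipartite)
  (λ { (_ , _ , refl , moduli) → bipartiteModuli⇒bipartite moduli })
theorem3p3 (_ ∷ _ ∷ _ ∷ _) _ ps = mk⇔
  (⊥-elim ∘ threeFactors⇒¬bipartite ps)
  (λ { (_ , _ , () , _) })
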